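{- There is a set $S$ of positive integers such that $$\frac{\log |S\cap[n]|}{\log n} \geq \frac{\log 2}{\log(1+\sqrt{2})} - o(1) \quad (n\to\infty),$$ and such that for each $n\in S$ there exists $k\in[n]$ with $\gcd(k,n)=1$ for which $k/n$ has a continued fraction expansion $k/n=[0;a_1,\ldots,a_m]$ whose partial quotients are bounded in average by $2$.
   Context: $[n]=\{1,\ldots,n\}$. The partial quotients $a_1,\ldots,a_m$ (positive integers) are bounded in average by $2$ if $\sum_{i=1}^t a_i\le 2t$ for every $1\le t\le m$. -}

module Defs where

open import Data.Nat using (ℕ; zero; suc; _+_; _*_; _∸_; _^_; _≤_; _<_)
open import Data.Nat.GCD using (gcd)
open import Data.List using (List; []; _∷_; length; take; filter; applyUpTo)
open import Data.Nat.ListAction using (sum)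
open import Data.List.Relation.Unary.All using (All)
open import Data.Product using (_×_; _,_; Σ; ∃; ∃-syntax)
open import Relation.Unary using (Pred; Decidable)
open import Relation.Binary.PropositionalEquality using (_≡_)
open import Level using (0ℓ)

interval : ℕ → List ℕ
interval n = applyUpTo suc n

countUpTo : {S : Pred ℕ 0ℓ} → Decidable S → ℕ → ℕ
countUpTo S? n = length (filter S? (interval n))

-- Value of the finite continued fraction [0; a₁, …, aₘ] as a pair (p , q)
-- meaning p / q:  [0;] = 0/1,  [0; a ∷ as] = 1 / (a + [0; as]).
cfValue : List ℕ → ℕ × ℕ
cfValue [] = 0 , 1
cfValue (a ∷ as) with cfValue as
... | p , q = q , a * q + p

IsCFExpansion : ℕ → ℕ → List ℕ → Set
IsCFExpansion k n as with cfValue as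
... | p , q = k * q ≡ n * p

BoundedInAverageBy2 : List ℕ → Set
BoundedInAverageBy2 as = ∀ t → 1 ≤ t → t ≤ length as → sum (take t as) ≤ 2 * t

-- (1+√2)^p = pellA p + pellB p · √2 with pellA, pellB natural numbers
pellA pellB : ℕ → ℕ
pellA zero = 1
pellA (suc p) = pellA p + 2 * pellB p
pellB zero = 0
pellB (suc p) = pellA p + pellB p

-- (1+√2)^p < 2^r, i.e. A + B√2 < 2^r  ⇔  A < 2^r  ∧  2B² < (2^r − A)²
PowLt : ℕ → ℕ → Set
PowLt p r = (pellA p < 2 ^ r) × (2 * (pellB p * pellB p) < (2 ^ r ∸ pellA p) * (2 ^ r ∸ pellA p))

{-# OPTIONS --safe #-}
-- S consists of the denominators n of [0; 2, …, 2, v] with 2 + ℓ leading twos followed by a word v of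
-- length ℓ whose partial sums satisfy a₁ + ⋯ + a_t ≤ 2t; the numerator k of that fraction is the required
-- witness.  There are ballot-number many such v, about 4^ℓ up to a polynomial factor.  Continued-fraction
-- steps are compared in ℕ[√2] with the coefficientwise order: a partial quotient a multiplies p + q δ
-- (δ = 1 + √2) by at most δ (√2)^a / 2, so the denominator of v is below pellB (2 + ℓ) ≈ δ^ℓ.  As
-- pellB (2 + ℓ) and pellB (3 + ℓ) are coprime the n are distinct, and they are at most pellA (5 + 2ℓ).
-- So S has about 4^ℓ elements below δ^(2ℓ), which gives the exponent log 2 / log (1 + √2); given δ^p < 2^r
-- (PowLt p r) the comparison of the exponential rates is carried out in integer arithmetic.
module Submission where

open import Defs
open import Algebra.Bundles using (CommutativeSemiring)
open import Data.Empty using (⊥; ⊥-elim)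
open import Data.List using (List; []; _∷_; length; replicate; _++_; map; take; upTo; filter)
open import Data.List.Membership.Propositional using (_∈_; _─_; lose)
open import Data.List.Membership.Propositional.Properties using (∈-map⁻; ∈-filter⁺; ∈-applyUpTo⁺; ∈-upTo⁺)
open import Data.List.Properties using (length-map; length-++; take-all; ∷-injectiveʳ; length-removeAt′)
open import Data.List.Relation.Binary.Disjoint.Propositional using (Disjoint)
open import Data.List.Relation.Unary.All as All using (All)
open import Data.List.Relation.Unary.All.Properties using (++⁺; map⁺; replicate⁺)
open import Data.List.Relation.Unary.AllPairs as AllPairs using ()
open import Data.List.Relation.Unary.Any as Any using (Any; here; there; any?; satisfied)
open import Data.List.Relation.Unary.Unique.Propositional using (Unique)
import Data.List.Relation.Unary.Unique.Propositional.Properties as Unique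
open import Data.Nat
open import Data.Nat.Coprimality using (Coprime; coprime-divisor; coprime⇒gcd≡1)
open import Data.Nat.DivMod using (_/_; _%_; m≡m%n+[m/n]*n; m%n<n; m*n/n≡m; /-monoˡ-≤)
open import Data.Nat.Divisibility using (_∣_; ∣1⇒≡1; ∣m+n∣m⇒∣n; ∣n⇒∣m*n; m∣m*n; ∣⇒≤)
open import Data.Nat.GCD using (gcd)
open import Data.Nat.ListAction using (sum)
open import Data.Nat.Properties
open import Data.Nat.Tactic.RingSolver using (solve; solve-∀)
open import Data.Product using (Σ; _×_; _,_; proj₁; proj₂; ∃-syntax)
open import Data.Sum using (inj₁; inj₂)
open import Level using (0ℓ)
open import Relation.Binary using (Rel; Preorder; tri<; tri≈; tri>)
open import Relation.Binary.PropositionalEquality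
import Relation.Binary.Reasoning.Preorder as PreorderReasoning
open import Relation.Nullary using (yes; no; contradiction)
open import Relation.Unary using (Pred; Decidable)


≤-by-offset : ∀ {m n} k → m + k ≡ n → m ≤ n
≤-by-offset k refl = m≤m+n _ k

^-distribʳ-* : ∀ m n k → (m * n) ^ k ≡ m ^ k * n ^ k
^-distribʳ-* m n zero    = refl
^-distribʳ-* m n (suc k) = trans (cong (m * n *_) (^-distribʳ-* m n k)) (e m n (m ^ k) (n ^ k))
  where
  e : ∀ a b x y → a * b * (x * y) ≡ a * x * (b * y)
  e = solve-∀

bernoulli : ∀ u n → u ^ n * (u + n) ≤ u * (1 + u) ^ n
bernoulli u zero    = ≤-reflexive (solve (u ∷ []))
bernoulli u (suc n) = begin
  u * u ^ n * (u + suc n)        ≡⟨ e₁ u (u ^ n) n ⟩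
  u ^ n * (u * (u + suc n))      ≤⟨ *-monoʳ-≤ (u ^ n) step ⟩
  u ^ n * ((1 + u) * (u + n))    ≡⟨ e₂ u (u ^ n) n ⟩
  (1 + u) * (u ^ n * (u + n))    ≤⟨ *-monoʳ-≤ (1 + u) (bernoulli u n) ⟩
  (1 + u) * (u * (1 + u) ^ n)    ≡⟨ e₃ u ((1 + u) ^ n) ⟩
  u * ((1 + u) * (1 + u) ^ n)    ∎
  where
  open ≤-Reasoning
  step : u * (u + suc n) ≤ (1 + u) * (u + n)
  step = ≤-by-offset n (solve (u ∷ n ∷ []))
  e₁ : ∀ u x n → u * x * (u + suc n) ≡ x * (u * (u + suc n))
  e₁ = solve-∀
  e₂ : ∀ u x n → x * ((1 + u) * (u + n)) ≡ (1 + u) * (x * (u + n))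
  e₂ = solve-∀
  e₃ : ∀ u y → (1 + u) * (u * y) ≡ u * ((1 + u) * y)
  e₃ = solve-∀

bernoulli-blocks : ∀ u t m K → (u + m) ^ K * u ^ (t + m * K) ≤ u ^ K * (1 + u) ^ (t + m * K)
bernoulli-blocks u t m K = begin
  (u + m) ^ K * u ^ (t + m * K)              ≡⟨ cong ((u + m) ^ K *_) (blocks u) ⟩
  (u + m) ^ K * (u ^ t * (u ^ m) ^ K)        ≡⟨ e₁ ((u + m) ^ K) (u ^ t) ((u ^ m) ^ K) ⟩
  u ^ t * ((u ^ m) ^ K * (u + m) ^ K)        ≡⟨ cong (u ^ t *_) (^-distribʳ-* (u ^ m) (u + m) K) ⟨
  u ^ t * (u ^ m * (u + m)) ^ K              ≤⟨ *-mono-≤ (^-monoˡ-≤ t (n≤1+n u)) (^-monoˡ-≤ K (bernoulli u m)) ⟩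
  (1 + u) ^ t * (u * (1 + u) ^ m) ^ K        ≡⟨ cong ((1 + u) ^ t *_) (^-distribʳ-* u ((1 + u) ^ m) K) ⟩
  (1 + u) ^ t * (u ^ K * ((1 + u) ^ m) ^ K)  ≡⟨ e₂ ((1 + u) ^ t) (u ^ K) (((1 + u) ^ m) ^ K) ⟩
  u ^ K * ((1 + u) ^ t * ((1 + u) ^ m) ^ K)  ≡⟨ cong (u ^ K *_) (blocks (1 + u)) ⟨
  u ^ K * (1 + u) ^ (t + m * K)              ∎
  where
  open ≤-Reasoning
  blocks : ∀ x → x ^ (t + m * K) ≡ x ^ t * (x ^ m) ^ K
  blocks x = trans (^-distribˡ-+-* x t (m * K)) (cong (x ^ t *_) (sym (^-*-assoc x m K)))
  e₁ : ∀ a b c → a * (b * c) ≡ b * (c * a)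
  e₁ = solve-∀
  e₂ : ∀ a b c → a * (b * c) ≡ b * (a * c)
  e₂ = solve-∀

-- Write ℓ = t + m (k + 1): Bernoulli on each of the k + 1 blocks of length m gains a factor (u + m) / u, and
-- (u + m)^(k + 1) beats C (2 + ℓ)^k u^(k + 1) once m is large.
poly*exp≤exp : ∀ C k u → ∃[ L ] ∀ ℓ → L ≤ ℓ → C * (2 + ℓ) ^ k * u ^ ℓ ≤ (1 + u) ^ ℓ
poly*exp≤exp C k zero = 1 , λ { (suc ℓ) _ → subst (_≤ 1 ^ suc ℓ) (sym (*-zeroʳ (C * (3 + ℓ) ^ k))) z≤n }
poly*exp≤exp C k u@(suc u′) = Z * K , bound
  where
  K = suc k
  Z = C * (2 * K) ^ k * u ^ K
  bound : ∀ ℓ → Z * K ≤ ℓ → C * (2 + ℓ) ^ k * u ^ ℓ ≤ (1 + u) ^ ℓ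
  bound ℓ ZK≤ℓ = *-cancelˡ-≤ (u ^ K) {{m^n≢0 u K}} (begin
    u ^ K * (C * (2 + ℓ) ^ k * u ^ ℓ)  ≡⟨ e₁ (u ^ K) (C * (2 + ℓ) ^ k) (u ^ ℓ) ⟩
    C * (2 + ℓ) ^ k * u ^ K * u ^ ℓ    ≤⟨ *-monoˡ-≤ (u ^ ℓ) poly≤ ⟩
    (u + m) ^ K * u ^ ℓ                ≡⟨ cong (λ n → (u + m) ^ K * u ^ n) ℓ≡ ⟩
    (u + m) ^ K * u ^ (t + m * K)      ≤⟨ bernoulli-blocks u t m K ⟩
    u ^ K * (1 + u) ^ (t + m * K)      ≡⟨ cong (λ n → u ^ K * (1 + u) ^ n) ℓ≡ ⟨
    u ^ K * (1 + u) ^ ℓ                ∎)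
    where
    open ≤-Reasoning
    e₁ : ∀ a b c → a * (b * c) ≡ b * a * c
    e₁ = solve-∀
    e₂ : ∀ k u′ m → 2 + (k + m * suc k) + (k + 2 * suc k * u′ + suc k * m) ≡ 2 * suc k * (suc u′ + m)
    e₂ = solve-∀
    e₃ : ∀ C a b c → C * (a * b) * c ≡ C * a * c * b
    e₃ = solve-∀
    m = ℓ / K
    t = ℓ % K
    ℓ≡ : ℓ ≡ t + m * K
    ℓ≡ = m≡m%n+[m/n]*n ℓ K
    2+ℓ≤ : 2 + ℓ ≤ 2 * K * (u + m)
    2+ℓ≤ = begin
      2 + ℓ             ≡⟨ cong (2 +_) ℓ≡ ⟩
      2 + (t + m * K)   ≤⟨ +-monoʳ-≤ 2 (+-monoˡ-≤ (m * K) (≤-pred (m%n<n ℓ K))) ⟩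
      2 + (k + m * K)   ≤⟨ ≤-by-offset (k + 2 * K * u′ + K * m) (e₂ k u′ m) ⟩
      2 * K * (u + m)   ∎
    poly≤ : C * (2 + ℓ) ^ k * u ^ K ≤ (u + m) ^ K
    poly≤ = begin
      C * (2 + ℓ) ^ k * u ^ K                  ≤⟨ *-monoˡ-≤ (u ^ K) (*-monoʳ-≤ C (^-monoˡ-≤ k 2+ℓ≤)) ⟩
      C * (2 * K * (u + m)) ^ k * u ^ K        ≡⟨ cong (λ x → C * x * u ^ K) (^-distribʳ-* (2 * K) (u + m) k) ⟩
      C * ((2 * K) ^ k * (u + m) ^ k) * u ^ K  ≡⟨ e₃ C ((2 * K) ^ k) ((u + m) ^ k) (u ^ K) ⟩
      Z * (u + m) ^ k                          ≤⟨ *-monoˡ-≤ ((u + m) ^ k) (≤-trans Z≤m (m≤n+m m u)) ⟩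
      (u + m) * (u + m) ^ k                    ∎
      where
      Z≤m : Z ≤ m
      Z≤m = subst (_≤ m) (m*n/n≡m Z K) (/-monoˡ-≤ K ZK≤ℓ)

bracket : ∀ (f : ℕ → ℕ) → (∀ k → k ≤ f k) → ∀ {L n} → f L ≤ n → ∃[ ℓ ] L ≤ ℓ × f ℓ ≤ n × n < f (suc ℓ)
bracket f unbounded {L} {n} fL≤n =
  search (suc n) L ≤-refl fL≤n (<-≤-trans (s≤s (m≤m+n n L)) (unbounded (suc n + L)))
  where
  search : ∀ d ℓ → L ≤ ℓ → f ℓ ≤ n → n < f (d + ℓ) → ∃[ ℓ′ ] L ≤ ℓ′ × f ℓ′ ≤ n × n < f (suc ℓ′)
  search zero    ℓ _   fℓ≤n n<fℓ = contradiction fℓ≤n (<⇒≱ n<fℓ)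
  search (suc d) ℓ L≤ℓ fℓ≤n n<f with n <? f (suc ℓ)
  ... | yes n<fℓ′ = ℓ , L≤ℓ , fℓ≤n , n<fℓ′
  ... | no  n≮fℓ′ =
    search d (suc ℓ) (m≤n⇒m≤1+n L≤ℓ) (≮⇒≥ n≮fℓ′) (subst (λ k → n < f k) (sym (+-suc d ℓ)) n<f)

private
  ∣∧<⇒≡0 : ∀ {b d} → b ∣ d → d < b → d ≡ 0
  ∣∧<⇒≡0 {d = zero}  _   _   = refl
  ∣∧<⇒≡0 {d = suc _} b∣d d<b = contradiction (∣⇒≤ b∣d) (<⇒≱ d<b)

  -- x′ = x + d forces b ∣ a d, hence b ∣ d, hence d = 0.
  coprime-combination-≤ : ∀ {a b x x′ y y′} → Coprime b a → x ≤ x′ → x′ < b →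
                          a * x + b * y ≡ a * x′ + b * y′ → x ≡ x′
  coprime-combination-≤ {a} {b} {x} {y = y} {y′} b⊥a x≤x′ x′<b eq with m≤n⇒∃[o]m+o≡n x≤x′
  ... | d , refl = sym (trans (cong (x +_) d≡0) (+-identityʳ x))
    where
    by≡ : b * y ≡ b * y′ + a * d
    by≡ = +-cancelˡ-≡ (a * x) _ _ (trans eq (solve (a ∷ x ∷ d ∷ b ∷ y′ ∷ [])))
    d≡0 : d ≡ 0
    d≡0 = ∣∧<⇒≡0 (coprime-divisor b⊥a (∣m+n∣m⇒∣n (subst (b ∣_) by≡ (m∣m*n y)) (m∣m*n y′)))
                 (≤-<-trans (m≤n+m d x) x′<b)

coprime-combination-injective : ∀ {a b x x′ y y′} → Coprime b a → x < b → x′ < b →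
                                a * x + b * y ≡ a * x′ + b * y′ → x ≡ x′
coprime-combination-injective {x = x} {x′} b⊥a x<b x′<b eq with ≤-total x x′
... | inj₁ x≤x′ = coprime-combination-≤ b⊥a x≤x′ x′<b eq
... | inj₂ x′≤x = sym (coprime-combination-≤ b⊥a x′≤x x<b (sym eq))

∈-─⁺ : ∀ {B : Set} {x y : B} {ys} (i : x ∈ ys) → y ∈ ys → y ≢ x → y ∈ ys ─ i
∈-─⁺ (here refl) (here refl) y≢x = ⊥-elim (y≢x refl)
∈-─⁺ (here _)    (there j)   _   = j
∈-─⁺ (there _)   (here refl) _   = here refl
∈-─⁺ (there i)   (there j)   y≢x = there (∈-─⁺ i j y≢x)

injection-length-≤ : ∀ {A B : Set} {xs : List A} {ys : List B} (f : A → B) → Unique xs →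
                     (∀ {x y} → x ∈ xs → y ∈ xs → f x ≡ f y → x ≡ y) → (∀ {x} → x ∈ xs → f x ∈ ys) →
                     length xs ≤ length ys
injection-length-≤ {xs = []}     _ _ _ _ = z≤n
injection-length-≤ {xs = x ∷ xs} {ys} f (x∉xs AllPairs.∷ unique) injective ∈ys =
  subst (suc (length xs) ≤_) (sym (length-removeAt′ ys (Any.index fx∈ys)))
        (s≤s (injection-length-≤ f unique (λ i j → injective (there i) (there j)) ∈ys─fx))
  where
  fx∈ys = ∈ys (here refl)
  ∈ys─fx : ∀ {y} → y ∈ xs → f y ∈ ys ─ fx∈ys
  ∈ys─fx y∈xs = ∈-─⁺ fx∈ys (∈ys (there y∈xs))
                  λ fy≡fx → All.lookup x∉xs y∈xs (injective (here refl) (there y∈xs) (sym fy≡fx))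

∈-interval : ∀ {n N} → 1 ≤ n → n ≤ N → n ∈ interval N
∈-interval {suc n} _ n<N = ∈-applyUpTo⁺ suc n<N


-- Continued fractions

cfNum cfDen : List ℕ → ℕ
cfNum w = proj₁ (cfValue w)
cfDen w = proj₂ (cfValue w)

private
  ≤-*+ : ∀ {a} q p → 1 ≤ a → q ≤ a * q + p
  ≤-*+ {suc a} q p _ = ≤-trans (m≤m+n q (a * q)) (m≤m+n _ p)

cfDen-pos : ∀ {w} → All (1 ≤_) w → 1 ≤ cfDen w
cfDen-pos All.[]                  = ≤-refl
cfDen-pos {a ∷ w} (1≤a All.∷ 1≤w) = ≤-trans (cfDen-pos 1≤w) (≤-*+ (cfDen w) (cfNum w) 1≤a)

cfNum≤cfDen : ∀ {w} → All (1 ≤_) w → cfNum w ≤ cfDen w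
cfNum≤cfDen All.[]                  = z≤n
cfNum≤cfDen {a ∷ w} (1≤a All.∷ 1≤w) = ≤-*+ (cfDen w) (cfNum w) 1≤a

cfNum≡0⇒[] : ∀ {w} → All (1 ≤_) w → cfNum w ≡ 0 → w ≡ []
cfNum≡0⇒[] All.[]         _   = refl
cfNum≡0⇒[] (_ All.∷ 1≤w) p≡0 with () ← subst (1 ≤_) p≡0 (cfDen-pos 1≤w)

cf-coprime : ∀ w → Coprime (cfNum w) (cfDen w)
cf-coprime []      (_ , d∣1)      = ∣1⇒≡1 d∣1
cf-coprime (a ∷ w) (d∣q , d∣aq+p) = cf-coprime w (∣m+n∣m⇒∣n d∣aq+p (∣n⇒∣m*n a d∣q) , d∣q)

cf-isExpansion : ∀ w → IsCFExpansion (cfNum w) (cfDen w) w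
cf-isExpansion w = *-comm (cfNum w) (cfDen w)

-- a q + p = a′ q + p′ with a < a′ forces p ≥ q + p′, which p ≤ q only allows when p = q and p′ = 0.
private
  quotient-< : ∀ {a a′ q p p′} → a < a′ → p ≤ q → a * q + p ≡ a′ * q + p′ → q ≤ p × p′ ≡ 0
  quotient-< {a} {a′} {q} {p} {p′} a<a′ p≤q eq with m≤n⇒∃[o]m+o≡n a<a′
  ... | e , refl = q≤p , p′≡0
    where
    p≡ : p ≡ q + (e * q + p′)
    p≡ = +-cancelˡ-≡ (a * q) _ _ (trans eq (solve (a ∷ e ∷ q ∷ p′ ∷ [])))
    q≤p : q ≤ p
    q≤p = subst (q ≤_) (sym p≡) (m≤m+n q _)
    p′≡0 : p′ ≡ 0
    p′≡0 = n≤0⇒n≡0 (≤-trans (m≤n+m p′ (e * q))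
                            (+-cancelˡ-≤ q _ 0 (subst₂ _≤_ p≡ (sym (+-identityʳ q)) p≤q)))

-- The lengths must agree: [0; a, 1] = [0; a + 1].
cfValue-injective : ∀ {w w′} → All (1 ≤_) w → All (1 ≤_) w′ → length w ≡ length w′ →
                    cfValue w ≡ cfValue w′ → w ≡ w′
cfValue-injective All.[] All.[] _ _ = refl
cfValue-injective {a ∷ w} {a′ ∷ w′} (_ All.∷ 1≤w) (_ All.∷ 1≤w′) len eq =
  cong₂ _∷_ a≡a′ (cfValue-injective 1≤w 1≤w′ (suc-injective len) (cong₂ _,_ p≡p′ q≡q′))
  where
  q≡q′ : cfDen w ≡ cfDen w′
  q≡q′ = cong proj₁ eq
  aq+p≡ : a * cfDen w + cfNum w ≡ a′ * cfDen w + cfNum w′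
  aq+p≡ = trans (cong proj₂ eq) (cong (λ q → a′ * q + cfNum w′) (sym q≡q′))
  impossible : ∀ {u u′} → All (1 ≤_) u′ → length u ≡ length u′ → cfDen u ≤ cfNum u → cfNum u′ ≡ 0 → ⊥
  impossible {[]}    _    _   ()
  impossible {_ ∷ _} 1≤u′ len _ p′≡0 with refl ← cfNum≡0⇒[] 1≤u′ p′≡0 with () ← len
  a≡a′ : a ≡ a′
  a≡a′ with <-cmp a a′
  ... | tri≈ _ a≡a′ _ = a≡a′
  ... | tri< a<a′ _ _ =
    let q≤p , p′≡0 = quotient-< a<a′ (cfNum≤cfDen 1≤w) aq+p≡
    in ⊥-elim (impossible {w} {w′} 1≤w′ (suc-injective len) q≤p p′≡0)
  ... | tri> _ _ a′<a =
    let q≤p′ , p≡0 = quotient-< a′<a (subst (_ ≤_) (sym q≡q′) (cfNum≤cfDen 1≤w′)) (sym aq+p≡)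
    in ⊥-elim (impossible {w′} {w} 1≤w (sym (suc-injective len)) (subst (_≤ _) q≡q′ q≤p′) p≡0)
  p≡p′ : cfNum w ≡ cfNum w′
  p≡p′ = +-cancelˡ-≡ (a * cfDen w) _ _ (trans aq+p≡ (cong (λ x → x * cfDen w + cfNum w′) (sym a≡a′)))


-- The semiring ℕ[√2] and the Pell numbers

infix  5 _+√2·_
infixl 6 _⊕_
infixl 7 _⊗_
infix  4 _≼_

data ℕ[√2] : Set where
  _+√2·_ : ℕ → ℕ → ℕ[√2]

_⊕_ _⊗_ : ℕ[√2] → ℕ[√2] → ℕ[√2]
(a +√2· b) ⊕ (c +√2· d) = (a + c) +√2· (b + d)
(a +√2· b) ⊗ (c +√2· d) = (a * c + 2 * (b * d)) +√2· (a * d + b * c)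

ι : ℕ → ℕ[√2]
ι n = n +√2· 0

⊕-assoc : ∀ u v w → u ⊕ v ⊕ w ≡ u ⊕ (v ⊕ w)
⊕-assoc (a +√2· b) (c +√2· d) (e +√2· f) = cong₂ _+√2·_ (+-assoc a c e) (+-assoc b d f)

⊕-comm : ∀ u v → u ⊕ v ≡ v ⊕ u
⊕-comm (a +√2· b) (c +√2· d) = cong₂ _+√2·_ (+-comm a c) (+-comm b d)

⊕-identityˡ : ∀ u → ι 0 ⊕ u ≡ u
⊕-identityˡ (a +√2· b) = refl

⊗-assoc : ∀ u v w → u ⊗ v ⊗ w ≡ u ⊗ (v ⊗ w)
⊗-assoc (a +√2· b) (c +√2· d) (e +√2· f) =
  cong₂ _+√2·_ (solve (a ∷ b ∷ c ∷ d ∷ e ∷ f ∷ [])) (solve (a ∷ b ∷ c ∷ d ∷ e ∷ f ∷ []))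

⊗-comm : ∀ u v → u ⊗ v ≡ v ⊗ u
⊗-comm (a +√2· b) (c +√2· d) = cong₂ _+√2·_ (solve (a ∷ b ∷ c ∷ d ∷ [])) (solve (a ∷ b ∷ c ∷ d ∷ []))

⊗-identityˡ : ∀ u → ι 1 ⊗ u ≡ u
⊗-identityˡ (a +√2· b) = cong₂ _+√2·_ (solve (a ∷ b ∷ [])) (solve (a ∷ b ∷ []))

⊗-zeroˡ : ∀ u → ι 0 ⊗ u ≡ ι 0
⊗-zeroˡ (a +√2· b) = cong₂ _+√2·_ (solve (b ∷ [])) refl

⊗-distribʳ-⊕ : ∀ u v w → (v ⊕ w) ⊗ u ≡ v ⊗ u ⊕ w ⊗ u
⊗-distribʳ-⊕ (a +√2· b) (c +√2· d) (e +√2· f) =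
  cong₂ _+√2·_ (solve (a ∷ b ∷ c ∷ d ∷ e ∷ f ∷ [])) (solve (a ∷ b ∷ c ∷ d ∷ e ∷ f ∷ []))

ι-* : ∀ m n → ι (m * n) ≡ ι m ⊗ ι n
ι-* m n = cong₂ _+√2·_ (solve (m ∷ n ∷ [])) (solve (m ∷ n ∷ []))

ℕ[√2]-commutativeSemiring : CommutativeSemiring 0ℓ 0ℓ
ℕ[√2]-commutativeSemiring = record
  { isCommutativeSemiring = IsCommutativeSemiringˡ.isCommutativeSemiring record
    { +-isCommutativeMonoid = IsCommutativeMonoidˡ.isCommutativeMonoid record
      { isSemigroup = record { isMagma = ≡-isMagma ; assoc = ⊕-assoc }
      ; identityˡ   = ⊕-identityˡ
      ; comm        = ⊕-comm
      }
    ; *-isCommutativeMonoid = IsCommutativeMonoidˡ.isCommutativeMonoid record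
      { isSemigroup = record { isMagma = ≡-isMagma ; assoc = ⊗-assoc }
      ; identityˡ   = ⊗-identityˡ
      ; comm        = ⊗-comm
      }
    ; distribʳ = ⊗-distribʳ-⊕
    ; zeroˡ    = ⊗-zeroˡ
    }
  }
  where
  open import Algebra.Structures {A = ℕ[√2]} _≡_ using (IsMagma)
  open import Algebra.Structures.Biased {A = ℕ[√2]} _≡_ using (IsCommutativeSemiringˡ; IsCommutativeMonoidˡ)
  ≡-isMagma : ∀ {_∙_} → IsMagma _∙_
  ≡-isMagma = record { isEquivalence = isEquivalence ; ∙-cong = cong₂ _ }

open import Algebra.Properties.CommutativeSemiring.Exp ℕ[√2]-commutativeSemiring
  using () renaming (_^_ to _^⊗_; ^-homo-* to ^⊗-homo-⊗; ^-assocʳ to ^⊗-assocʳ; ^-distrib-* to ^⊗-distrib-⊗)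
open import Algebra.Properties.CommutativeSemigroup
  (CommutativeSemiring.*-commutativeSemigroup ℕ[√2]-commutativeSemiring)
  using (interchange; x∙yz≈y∙xz; xy∙z≈x∙zy; xy∙z≈xz∙y)

-- Coefficientwise order; it implies the order of the real numbers a + b√2.
_≼_ : Rel ℕ[√2] 0ℓ
(a +√2· b) ≼ (c +√2· d) = a ≤ c × b ≤ d

≼-reflexive : ∀ {u v} → u ≡ v → u ≼ v
≼-reflexive {a +√2· b} refl = ≤-refl , ≤-refl

≼-refl : ∀ {u} → u ≼ u
≼-refl = ≼-reflexive refl

≼-trans : ∀ {u v w} → u ≼ v → v ≼ w → u ≼ w
≼-trans {_ +√2· _} {_ +√2· _} {_ +√2· _} (a≤c , b≤d) (c≤e , d≤f) = ≤-trans a≤c c≤e , ≤-trans b≤d d≤f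

≼-preorder : Preorder 0ℓ 0ℓ 0ℓ
≼-preorder = record
  { isPreorder = record { isEquivalence = isEquivalence ; reflexive = ≼-reflexive ; trans = ≼-trans } }

module ≼-Reasoning = PreorderReasoning ≼-preorder

⊕-mono-≼ : ∀ {u u′ v v′} → u ≼ u′ → v ≼ v′ → u ⊕ v ≼ u′ ⊕ v′
⊕-mono-≼ {_ +√2· _} {_ +√2· _} {_ +√2· _} {_ +√2· _} (a , b) (c , d) = +-mono-≤ a c , +-mono-≤ b d

⊗-mono-≼ : ∀ {u u′ v v′} → u ≼ u′ → v ≼ v′ → u ⊗ v ≼ u′ ⊗ v′
⊗-mono-≼ {_ +√2· _} {_ +√2· _} {_ +√2· _} {_ +√2· _} (a , b) (c , d) =
  +-mono-≤ (*-mono-≤ a c) (*-monoʳ-≤ 2 (*-mono-≤ b d)) , +-mono-≤ (*-mono-≤ a d) (*-mono-≤ b c)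

^⊗-mono-≼ : ∀ {u v} n → u ≼ v → u ^⊗ n ≼ v ^⊗ n
^⊗-mono-≼ zero    _   = ≤-refl , ≤-refl
^⊗-mono-≼ (suc n) u≼v = ⊗-mono-≼ u≼v (^⊗-mono-≼ n u≼v)

rat irr : ℕ[√2] → ℕ
rat (a +√2· _) = a
irr (_ +√2· b) = b

ι-^ : ∀ m n → ι m ^⊗ n ≡ ι (m ^ n)
ι-^ m zero    = refl
ι-^ m (suc n) = trans (cong (ι m ⊗_) (ι-^ m n)) (sym (ι-* m (m ^ n)))

-- √2δ = √2 · δ.
δ √2δ : ℕ[√2]
δ   = 1 +√2· 1
√2δ = 2 +√2· 1

δ^⊗-pell : ∀ n → δ ^⊗ n ≡ pellA n +√2· pellB n
δ^⊗-pell zero    = refl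
δ^⊗-pell (suc n) rewrite δ^⊗-pell n = cong₂ _+√2·_ (step (pellA n) (pellB n)) (step′ (pellA n) (pellB n))
  where
  step : ∀ a b → 1 * a + 2 * (1 * b) ≡ a + 2 * b
  step = solve-∀
  step′ : ∀ a b → 1 * b + 1 * a ≡ a + b
  step′ = solve-∀

√2δ^⊗-even : ∀ n → √2δ ^⊗ (2 * n) ≡ ι (2 ^ n) ⊗ δ ^⊗ (2 * n)
√2δ^⊗-even n = begin
  √2δ ^⊗ (2 * n)               ≡⟨ ^⊗-assocʳ √2δ 2 n ⟨
  (ι 2 ⊗ δ ^⊗ 2) ^⊗ n          ≡⟨ ^⊗-distrib-⊗ (ι 2) (δ ^⊗ 2) n ⟩
  ι 2 ^⊗ n ⊗ (δ ^⊗ 2) ^⊗ n     ≡⟨ cong₂ _⊗_ (ι-^ 2 n) (^⊗-assocʳ δ 2 n) ⟩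
  ι (2 ^ n) ⊗ δ ^⊗ (2 * n)     ∎
  where open ≡-Reasoning

pell-+ : ∀ m n → pellA (m + n) +√2· pellB (m + n) ≡ (pellA m +√2· pellB m) ⊗ (pellA n +√2· pellB n)
pell-+ m n = trans (sym (δ^⊗-pell (m + n))) (trans (^⊗-homo-⊗ δ m n) (cong₂ _⊗_ (δ^⊗-pell m) (δ^⊗-pell n)))

pellA-+ : ∀ m n → pellA (m + n) ≡ pellA m * pellA n + 2 * (pellB m * pellB n)
pellA-+ m n = cong rat (pell-+ m n)

pellB-+ : ∀ m n → pellB (m + n) ≡ pellA m * pellB n + pellB m * pellA n
pellB-+ m n = cong irr (pell-+ m n)

pellA-pos : ∀ n → 1 ≤ pellA n
pellA-pos zero    = ≤-refl
pellA-pos (suc n) = ≤-trans (pellA-pos n) (m≤m+n (pellA n) _)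

n≤pellB : ∀ n → n ≤ pellB n
n≤pellB zero    = z≤n
n≤pellB (suc n) = +-mono-≤ (pellA-pos n) (n≤pellB n)

pellB≤pellA : ∀ n → pellB n ≤ pellA n
pellB≤pellA zero    = z≤n
pellB≤pellA (suc n) = +-monoʳ-≤ (pellA n) (m≤m+n (pellB n) _)

pellA≤2*pellB : ∀ n → pellA (suc n) ≤ 2 * pellB (suc n)
pellA≤2*pellB n = ≤-by-offset (pellA n) (identity (pellA n) (pellB n))
  where
  identity : ∀ a b → a + 2 * b + a ≡ 2 * (a + b)
  identity = solve-∀

pellB-rec : ∀ n → pellB (2 + n) ≡ 2 * pellB (1 + n) + pellB n
pellB-rec n = identity (pellA n) (pellB n)
  where
  identity : ∀ a b → a + 2 * b + (a + b) ≡ 2 * (a + b) + b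
  identity = solve-∀

pellB-suc+pellB : ∀ n → pellB (suc n) + pellB n ≡ pellA (suc n)
pellB-suc+pellB n = identity (pellA n) (pellB n)
  where
  identity : ∀ a b → a + b + b ≡ a + 2 * b
  identity = solve-∀

pellA-*-≤ : ∀ m n → pellA m * pellA n ≤ pellA (m + n)
pellA-*-≤ m n = subst (pellA m * pellA n ≤_) (sym (pellA-+ m n)) (m≤m+n _ _)

pellA-^-≤ : ∀ n k → pellA n ^ k ≤ pellA (k * n)
pellA-^-≤ n zero    = ≤-refl
pellA-^-≤ n (suc k) = ≤-trans (*-monoʳ-≤ (pellA n) (pellA-^-≤ n k)) (pellA-*-≤ n (k * n))

pellB-gap : ∀ ℓ → pellB (1 + 3 * ℓ) < pellB (2 + ℓ) * pellB (1 + 2 * ℓ)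
pellB-gap ℓ = begin-strict
  pellB (1 + 3 * ℓ)                          ≡⟨ cong pellB (split ℓ) ⟩
  pellB (ℓ + (1 + 2 * ℓ))                    ≡⟨ pellB-+ ℓ (1 + 2 * ℓ) ⟩
  A * B′ + B * A′                            ≤⟨ +-monoʳ-≤ (A * B′) (*-monoʳ-≤ B (pellA≤2*pellB (2 * ℓ))) ⟩
  A * B′ + B * (2 * B′)                      <⟨ m<m+n _ (≤-trans AB′≥1 (m≤m+n (A * B′) (B * B′))) ⟩
  A * B′ + B * (2 * B′) + (A * B′ + B * B′)  ≡⟨ identity A B B′ ⟩
  (A + 2 * B + (A + B)) * B′                 ∎
  where
  open ≤-Reasoning
  A = pellA ℓ
  B = pellB ℓ
  A′ = pellA (1 + 2 * ℓ)
  B′ = pellB (1 + 2 * ℓ)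
  AB′≥1 : 1 ≤ A * B′
  AB′≥1 = *-mono-≤ (pellA-pos ℓ) (≤-trans (s≤s z≤n) (n≤pellB (1 + 2 * ℓ)))
  split : ∀ ℓ → 1 + 3 * ℓ ≡ ℓ + (1 + 2 * ℓ)
  split = solve-∀
  identity : ∀ A B B′ → A * B′ + B * (2 * B′) + (A * B′ + B * B′) ≡ (A + 2 * B + (A + B)) * B′
  identity = solve-∀

pellB-coprime : ∀ n → Coprime (pellB n) (pellB (suc n))
pellB-coprime zero    (_ , d∣1)   = ∣1⇒≡1 d∣1
pellB-coprime (suc n) {d} (d∣B₁ , d∣B₂) =
  pellB-coprime n (∣m+n∣m⇒∣n (subst (d ∣_) (pellB-rec n) d∣B₂) (∣n⇒∣m*n 2 d∣B₁) , d∣B₁)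


-- Denominators of words with partial quotients averaging at most 2

infix 5 _+δ·_
_+δ·_ : ℕ → ℕ → ℕ[√2]
p +δ· q = (p + q) +√2· q

δ≼√2δ : δ ≼ √2δ
δ≼√2δ = s≤s z≤n , ≤-refl

2δ^⊗≼√2δ^⊗ : ∀ n → 2 ≤ n → ι 2 ⊗ δ ^⊗ n ≼ √2δ ^⊗ n
2δ^⊗≼√2δ^⊗ 0                   ()
2δ^⊗≼√2δ^⊗ 1                   (s≤s ())
2δ^⊗≼√2δ^⊗ 2                   _ = ≤-refl , ≤-refl
2δ^⊗≼√2δ^⊗ (suc n@(suc (suc _))) _ = begin
  ι 2 ⊗ (δ ⊗ δ ^⊗ n)  ≡⟨ x∙yz≈y∙xz (ι 2) δ (δ ^⊗ n) ⟩
  δ ⊗ (ι 2 ⊗ δ ^⊗ n)  ≲⟨ ⊗-mono-≼ δ≼√2δ (2δ^⊗≼√2δ^⊗ n (s≤s (s≤s z≤n))) ⟩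
  √2δ ⊗ √2δ ^⊗ n      ∎
  where open ≼-Reasoning

qδ≼p+qδ : ∀ p q → ι q ⊗ δ ≼ p +δ· q
qδ≼p+qδ p q = ≤-by-offset p (solve (q ∷ p ∷ [])) , ≤-reflexive (solve (q ∷ []))

-- Prepending a partial quotient a turns p/q into q/(a q + p); this multiplies p + q δ by at most
-- δ (√2)^a / 2, with equality for a = 2.
cf-step-≼ : ∀ {p q} a → 1 ≤ a → p ≤ q →
            ι 2 ⊗ δ ^⊗ a ⊗ (q +δ· (a * q + p)) ≼ δ ⊗ √2δ ^⊗ a ⊗ (p +δ· q)
cf-step-≼ 1 _ p≤q = step₁ p≤q
  where
  step₁ : ∀ {p q} → p ≤ q → ι 2 ⊗ δ ^⊗ 1 ⊗ (q +δ· (1 * q + p)) ≼ δ ⊗ √2δ ^⊗ 1 ⊗ (p +δ· q)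
  step₁ {p} p≤q with m≤n⇒∃[o]m+o≡n p≤q
  ... | d , refl = ≤-by-offset (2 * d) (solve (p ∷ d ∷ [])) , ≤-by-offset d (solve (p ∷ d ∷ []))
cf-step-≼ {p} {q} 2 _ _ = ≼-reflexive (step₂ p q)
  where
  step₂ : ∀ p q → ι 2 ⊗ δ ^⊗ 2 ⊗ (q +δ· (2 * q + p)) ≡ δ ⊗ √2δ ^⊗ 2 ⊗ (p +δ· q)
  step₂ p q = cong₂ _+√2·_ (solve (p ∷ q ∷ [])) (solve (p ∷ q ∷ []))
cf-step-≼ {p} {q} (suc n@(suc (suc _))) _ p≤q = begin
  ι 2 ⊗ (δ ⊗ δ ^⊗ n) ⊗ (q +δ· (suc n * q + p))
    ≡⟨ split n q p (δ ^⊗ n) ⟩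
  δ ⊗ (ι 2 ⊗ δ ^⊗ n ⊗ (q +δ· (n * q + p))) ⊕ δ ⊗ (ι 2 ⊗ δ ^⊗ n) ⊗ (ι q ⊗ δ)
    ≲⟨ ⊕-mono-≼ (⊗-mono-≼ (≼-refl {δ}) (cf-step-≼ n (s≤s z≤n) p≤q))
                (⊗-mono-≼ (⊗-mono-≼ (≼-refl {δ}) (2δ^⊗≼√2δ^⊗ n (s≤s (s≤s z≤n)))) (qδ≼p+qδ p q)) ⟩
  δ ⊗ (δ ⊗ √2δ ^⊗ n ⊗ (p +δ· q)) ⊕ δ ⊗ √2δ ^⊗ n ⊗ (p +δ· q)
    ≡⟨ merge (√2δ ^⊗ n) (p +δ· q) ⟩
  δ ⊗ (√2δ ⊗ √2δ ^⊗ n) ⊗ (p +δ· q) ∎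
  where
  open ≼-Reasoning
  split : ∀ n q p X → ι 2 ⊗ (δ ⊗ X) ⊗ (q +δ· (suc n * q + p))
                    ≡ δ ⊗ (ι 2 ⊗ X ⊗ (q +δ· (n * q + p))) ⊕ δ ⊗ (ι 2 ⊗ X) ⊗ (ι q ⊗ δ)
  split n q p (x +√2· y) = cong₂ _+√2·_ (solve (n ∷ q ∷ p ∷ x ∷ y ∷ [])) (solve (n ∷ q ∷ p ∷ x ∷ y ∷ []))
  merge : ∀ Y P → δ ⊗ (δ ⊗ Y ⊗ P) ⊕ δ ⊗ Y ⊗ P ≡ δ ⊗ (√2δ ⊗ Y) ⊗ P
  merge (y +√2· y′) (r +√2· r′) = cong₂ _+√2·_ (solve (y ∷ y′ ∷ r ∷ r′ ∷ [])) (solve (y ∷ y′ ∷ r ∷ r′ ∷ []))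

-- Over the reals: q ≤ δ^ℓ · 2^(σ/2 − ℓ) for a word of length ℓ and sum σ.
cf-≼ : ∀ {w} → All (1 ≤_) w →
       ι (2 ^ length w) ⊗ δ ^⊗ sum w ⊗ (cfNum w +δ· cfDen w) ≼ δ ^⊗ suc (length w) ⊗ √2δ ^⊗ sum w
cf-≼ All.[] = ≤-refl , ≤-refl
cf-≼ {a ∷ w} (1≤a All.∷ 1≤w) = begin
  ι (2 ^ suc ℓ) ⊗ δ ^⊗ (a + σ) ⊗ N
    ≡⟨ cong₂ (λ x y → x ⊗ y ⊗ N) (ι-* 2 (2 ^ ℓ)) (^⊗-homo-⊗ δ a σ) ⟩
  ι 2 ⊗ ι (2 ^ ℓ) ⊗ (δ ^⊗ a ⊗ δ ^⊗ σ) ⊗ N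
    ≡⟨ trans (cong (_⊗ N) (interchange (ι 2) (ι (2 ^ ℓ)) (δ ^⊗ a) (δ ^⊗ σ)))
             (xy∙z≈xz∙y (ι 2 ⊗ δ ^⊗ a) (ι (2 ^ ℓ) ⊗ δ ^⊗ σ) N) ⟩
  ι 2 ⊗ δ ^⊗ a ⊗ N ⊗ (ι (2 ^ ℓ) ⊗ δ ^⊗ σ)
    ≲⟨ ⊗-mono-≼ (cf-step-≼ a 1≤a (cfNum≤cfDen 1≤w)) ≼-refl ⟩
  δ ⊗ √2δ ^⊗ a ⊗ P ⊗ (ι (2 ^ ℓ) ⊗ δ ^⊗ σ)
    ≡⟨ xy∙z≈x∙zy (δ ⊗ √2δ ^⊗ a) P (ι (2 ^ ℓ) ⊗ δ ^⊗ σ) ⟩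
  δ ⊗ √2δ ^⊗ a ⊗ (ι (2 ^ ℓ) ⊗ δ ^⊗ σ ⊗ P)
    ≲⟨ ⊗-mono-≼ ≼-refl (cf-≼ 1≤w) ⟩
  δ ⊗ √2δ ^⊗ a ⊗ (δ ^⊗ suc ℓ ⊗ √2δ ^⊗ σ)
    ≡⟨ interchange δ (√2δ ^⊗ a) (δ ^⊗ suc ℓ) (√2δ ^⊗ σ) ⟩
  δ ^⊗ suc (suc ℓ) ⊗ (√2δ ^⊗ a ⊗ √2δ ^⊗ σ)
    ≡⟨ cong (δ ^⊗ suc (suc ℓ) ⊗_) (^⊗-homo-⊗ √2δ a σ) ⟨
  δ ^⊗ suc (suc ℓ) ⊗ √2δ ^⊗ (a + σ) ∎
  where
  open ≼-Reasoning
  ℓ = length w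
  σ = sum w
  N = cfNum (a ∷ w) +δ· cfDen (a ∷ w)
  P = cfNum w +δ· cfDen w

ι⊗δ^⊗-≼⇒ : ∀ {c d m n} → ι c ⊗ δ ^⊗ m ≼ ι d ⊗ δ ^⊗ n → c * pellB m ≤ d * pellB n
ι⊗δ^⊗-≼⇒ {c} {d} {m} {n} le =
  subst₂ _≤_ (+-identityʳ (c * pellB m)) (+-identityʳ (d * pellB n))
    (proj₂ (subst₂ (λ u v → ι c ⊗ u ≼ ι d ⊗ v) (δ^⊗-pell m) (δ^⊗-pell n) le))

-- Pad the sum σ of the partial quotients up to 2ℓ with factors √2δ ≽ δ, then use √2δ ^⊗ 2 = ι 2 ⊗ δ ^⊗ 2.
cfDen-≼ : ∀ {w} → All (1 ≤_) w → sum w ≤ 2 * length w →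
          ι (2 ^ length w * cfDen w) ⊗ δ ^⊗ (1 + 2 * length w) ≼ ι (2 ^ length w) ⊗ δ ^⊗ (1 + 3 * length w)
cfDen-≼ {w} 1≤w σ≤2ℓ = begin
  ι (2 ^ ℓ * q) ⊗ (δ ⊗ δ ^⊗ (2 * ℓ))
    ≡⟨ cong₂ (λ x y → x ⊗ (δ ⊗ y)) (ι-* (2 ^ ℓ) q) (trans (cong (δ ^⊗_) (sym σ+k≡2ℓ)) (^⊗-homo-⊗ δ σ k)) ⟩
  ι (2 ^ ℓ) ⊗ ι q ⊗ (δ ⊗ (δ ^⊗ σ ⊗ δ ^⊗ k))
    ≡⟨ regroup (ι (2 ^ ℓ)) (δ ^⊗ σ) (ι q) δ (δ ^⊗ k) ⟩
  ι (2 ^ ℓ) ⊗ δ ^⊗ σ ⊗ (ι q ⊗ δ) ⊗ δ ^⊗ k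
    ≲⟨ ⊗-mono-≼ (⊗-mono-≼ ≼-refl (qδ≼p+qδ (cfNum w) q)) (^⊗-mono-≼ k δ≼√2δ) ⟩
  ι (2 ^ ℓ) ⊗ δ ^⊗ σ ⊗ (cfNum w +δ· q) ⊗ √2δ ^⊗ k
    ≲⟨ ⊗-mono-≼ (cf-≼ 1≤w) ≼-refl ⟩
  δ ^⊗ suc ℓ ⊗ √2δ ^⊗ σ ⊗ √2δ ^⊗ k
    ≡⟨ ⊗-assoc (δ ^⊗ suc ℓ) (√2δ ^⊗ σ) (√2δ ^⊗ k) ⟩
  δ ^⊗ suc ℓ ⊗ (√2δ ^⊗ σ ⊗ √2δ ^⊗ k)
    ≡⟨ cong (δ ^⊗ suc ℓ ⊗_) (trans (sym (^⊗-homo-⊗ √2δ σ k)) (trans (cong (√2δ ^⊗_) σ+k≡2ℓ) (√2δ^⊗-even ℓ))) ⟩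
  δ ^⊗ suc ℓ ⊗ (ι (2 ^ ℓ) ⊗ δ ^⊗ (2 * ℓ))
    ≡⟨ x∙yz≈y∙xz (δ ^⊗ suc ℓ) (ι (2 ^ ℓ)) (δ ^⊗ (2 * ℓ)) ⟩
  ι (2 ^ ℓ) ⊗ (δ ^⊗ suc ℓ ⊗ δ ^⊗ (2 * ℓ))
    ≡⟨ cong (ι (2 ^ ℓ) ⊗_) (trans (sym (^⊗-homo-⊗ δ (suc ℓ) (2 * ℓ))) (cong (δ ^⊗_) (e ℓ))) ⟩
  ι (2 ^ ℓ) ⊗ δ ^⊗ (1 + 3 * ℓ) ∎
  where
  open ≼-Reasoning
  ℓ = length w
  σ = sum w
  k = 2 * ℓ ∸ σ
  q = cfDen w
  σ+k≡2ℓ : σ + k ≡ 2 * ℓ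
  σ+k≡2ℓ = m+[n∸m]≡n σ≤2ℓ
  e : ∀ ℓ → suc ℓ + 2 * ℓ ≡ 1 + 3 * ℓ
  e = solve-∀
  regroup : ∀ t s r d k → t ⊗ r ⊗ (d ⊗ (s ⊗ k)) ≡ t ⊗ s ⊗ (r ⊗ d) ⊗ k
  regroup t s r d k = trans (cong (t ⊗ r ⊗_) (x∙yz≈y∙xz d s k))
                     (trans (interchange t r s (d ⊗ k)) (sym (trans (⊗-assoc (t ⊗ s) (r ⊗ d) k)
                                                                      (cong (t ⊗ s ⊗_) (⊗-assoc r d k)))))

cfDen-bound : ∀ {w} → All (1 ≤_) w → sum w ≤ 2 * length w →
              cfDen w * pellB (1 + 2 * length w) ≤ pellB (1 + 3 * length w)
cfDen-bound {w} 1≤w σ≤2ℓ = *-cancelˡ-≤ (2 ^ ℓ) {{m^n≢0 2 ℓ}}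
  (subst (_≤ 2 ^ ℓ * pellB (1 + 3 * ℓ)) (*-assoc (2 ^ ℓ) (cfDen w) _)
         (ι⊗δ^⊗-≼⇒ {m = 1 + 2 * ℓ} {n = 1 + 3 * ℓ} (cfDen-≼ 1≤w σ≤2ℓ)))
  where ℓ = length w

cfDen<pellB : ∀ {w} → All (1 ≤_) w → sum w ≤ 2 * length w → cfDen w < pellB (2 + length w)
cfDen<pellB {w} 1≤w σ≤2ℓ =
  *-cancelʳ-< (pellB (1 + 2 * ℓ)) _ _ (≤-<-trans (cfDen-bound 1≤w σ≤2ℓ) (pellB-gap ℓ))
  where ℓ = length w


-- Good words and ballot numbers

PrefixBounded : ℕ → List ℕ → Set
PrefixBounded s w = ∀ t → sum (take t w) ≤ s + 2 * t

prefixBounded-∷ : ∀ {a k s w} → a + k ≡ 2 + s → PrefixBounded k w → PrefixBounded s (a ∷ w)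
prefixBounded-∷ _ _ zero = z≤n
prefixBounded-∷ {a} {k} {s} {w} a+k≡2+s bounded (suc t) = begin
  a + sum (take t w)  ≤⟨ +-monoʳ-≤ a (bounded t) ⟩
  a + (k + 2 * t)     ≡⟨ +-assoc a k (2 * t) ⟨
  a + k + 2 * t       ≡⟨ cong (_+ 2 * t) a+k≡2+s ⟩
  2 + s + 2 * t       ≡⟨ solve (s ∷ t ∷ []) ⟩
  s + 2 * suc t       ∎
  where open ≤-Reasoning

prefixBounded-twos : ∀ n {v} → PrefixBounded 0 v → PrefixBounded 0 (replicate n 2 ++ v)
prefixBounded-twos zero    bounded = bounded
prefixBounded-twos (suc n) bounded = prefixBounded-∷ {k = 0} refl (prefixBounded-twos n bounded)

prefixBounded⇒boundedInAverageBy2 : ∀ {w} → PrefixBounded 0 w → BoundedInAverageBy2 w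
prefixBounded⇒boundedInAverageBy2 bounded t _ _ = bounded t

record GoodWord (ℓ s : ℕ) (w : List ℕ) : Set where
  field
    length≡  : length w ≡ ℓ
    positive : All (1 ≤_) w
    bounded  : PrefixBounded s w

goodWord-sum : ∀ {ℓ w} → GoodWord ℓ 0 w → sum w ≤ 2 * ℓ
goodWord-sum {ℓ} {w} good = begin
  sum w                    ≡⟨ cong sum (take-all (length w) w ≤-refl) ⟨
  sum (take (length w) w)  ≤⟨ bounded (length w) ⟩
  2 * length w             ≡⟨ cong (2 *_) length≡ ⟩
  2 * ℓ                    ∎
  where
  open GoodWord good
  open ≤-Reasoning

goodWord-∷ : ∀ {ℓ a k s w} → 1 ≤ a → a + k ≡ 2 + s → GoodWord ℓ k w → GoodWord (suc ℓ) s (a ∷ w)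
goodWord-∷ 1≤a a+k≡2+s good = record
  { length≡  = cong suc length≡
  ; positive = 1≤a All.∷ positive
  ; bounded  = prefixBounded-∷ a+k≡2+s bounded
  }
  where open GoodWord good

-- goodWordsFrom ℓ a k lists the words a′ ∷ w with a ≤ a′ ≤ a + k and w ∈ goodWords ℓ (a + k ∸ a′).
mutual
  goodWords : ℕ → ℕ → List (List ℕ)
  goodWords zero    s = [] ∷ []
  goodWords (suc ℓ) s = goodWordsFrom ℓ 1 (suc s)

  goodWordsFrom : ℕ → ℕ → ℕ → List (List ℕ)
  goodWordsFrom ℓ a zero    = map (a ∷_) (goodWords ℓ zero)
  goodWordsFrom ℓ a (suc k) = map (a ∷_) (goodWords ℓ (suc k)) ++ goodWordsFrom ℓ (suc a) k

mutual
  goodWords-sound : ∀ ℓ s → All (GoodWord ℓ s) (goodWords ℓ s)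
  goodWords-sound zero    s = empty All.∷ All.[]
    where
    empty : GoodWord 0 s []
    empty = record { length≡ = refl ; positive = All.[] ; bounded = λ { zero → z≤n ; (suc _) → z≤n } }
  goodWords-sound (suc ℓ) s = goodWordsFrom-sound ℓ 1 (suc s) (s≤s z≤n) refl

  goodWordsFrom-sound : ∀ ℓ a k {s} → 1 ≤ a → a + k ≡ 2 + s → All (GoodWord (suc ℓ) s) (goodWordsFrom ℓ a k)
  goodWordsFrom-sound ℓ a zero    1≤a eq = map⁺ (All.map (goodWord-∷ 1≤a eq) (goodWords-sound ℓ zero))
  goodWordsFrom-sound ℓ a (suc k) 1≤a eq =
    ++⁺ (map⁺ (All.map (goodWord-∷ 1≤a eq) (goodWords-sound ℓ (suc k))))
        (goodWordsFrom-sound ℓ (suc a) k (s≤s z≤n) (trans (sym (+-suc a k)) eq))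

StartsFrom : ℕ → List ℕ → Set
StartsFrom a []      = ⊥
StartsFrom a (b ∷ _) = a ≤ b

goodWordsFrom-starts : ∀ ℓ a k → All (StartsFrom a) (goodWordsFrom ℓ a k)
goodWordsFrom-starts ℓ a zero    = map⁺ (All.universal (λ _ → ≤-refl) _)
goodWordsFrom-starts ℓ a (suc k) =
  ++⁺ (map⁺ (All.universal (λ _ → ≤-refl) _)) (All.map weaken (goodWordsFrom-starts ℓ (suc a) k))
  where
  weaken : ∀ {w} → StartsFrom (suc a) w → StartsFrom a w
  weaken {_ ∷ _} a<b = <⇒≤ a<b

mutual
  goodWords-unique : ∀ ℓ s → Unique (goodWords ℓ s)
  goodWords-unique zero    s = All.[] AllPairs.∷ AllPairs.[]
  goodWords-unique (suc ℓ) s = goodWordsFrom-unique ℓ 1 (suc s)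

  goodWordsFrom-unique : ∀ ℓ a k → Unique (goodWordsFrom ℓ a k)
  goodWordsFrom-unique ℓ a zero    = Unique.map⁺ ∷-injectiveʳ (goodWords-unique ℓ zero)
  goodWordsFrom-unique ℓ a (suc k) =
    Unique.++⁺ (Unique.map⁺ ∷-injectiveʳ (goodWords-unique ℓ (suc k))) (goodWordsFrom-unique ℓ (suc a) k) disjoint
    where
    disjoint : Disjoint (map (a ∷_) (goodWords ℓ (suc k))) (goodWordsFrom ℓ (suc a) k)
    disjoint (v∈here , v∈later) with ∈-map⁻ (a ∷_) v∈here
    ... | _ , _ , refl = <-irrefl refl (All.lookup (goodWordsFrom-starts ℓ (suc a) k) v∈later)

#goodWords : ℕ → ℕ → ℕ
#goodWords ℓ s = length (goodWords ℓ s)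

length-goodWordsFrom : ∀ ℓ a b k → length (goodWordsFrom ℓ a k) ≡ length (goodWordsFrom ℓ b k)
length-goodWordsFrom ℓ a b zero    = trans (length-map (a ∷_) W) (sym (length-map (b ∷_) W))
  where W = goodWords ℓ 0
length-goodWordsFrom ℓ a b (suc k) = begin
  length (map (a ∷_) W ++ goodWordsFrom ℓ (suc a) k)
    ≡⟨ length-++ (map (a ∷_) W) ⟩
  length (map (a ∷_) W) + length (goodWordsFrom ℓ (suc a) k)
    ≡⟨ cong₂ _+_ (trans (length-map (a ∷_) W) (sym (length-map (b ∷_) W)))
                 (length-goodWordsFrom ℓ (suc a) (suc b) k) ⟩
  length (map (b ∷_) W) + length (goodWordsFrom ℓ (suc b) k)
    ≡⟨ length-++ (map (b ∷_) W) ⟨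
  length (map (b ∷_) W ++ goodWordsFrom ℓ (suc b) k) ∎
  where
  open ≡-Reasoning
  W = goodWords ℓ (suc k)

#goodWords-suc-zero : ∀ ℓ → #goodWords (suc ℓ) 0 ≡ #goodWords ℓ 1 + #goodWords ℓ 0
#goodWords-suc-zero ℓ = trans (length-++ (map (1 ∷_) (goodWords ℓ 1)))
                              (cong₂ _+_ (length-map (1 ∷_) (goodWords ℓ 1)) (length-map (2 ∷_) (goodWords ℓ 0)))

#goodWords-suc-suc : ∀ ℓ s → #goodWords (suc ℓ) (suc s) ≡ #goodWords ℓ (2 + s) + #goodWords (suc ℓ) s
#goodWords-suc-suc ℓ s = trans (length-++ (map (1 ∷_) (goodWords ℓ (2 + s))))
                               (cong₂ _+_ (length-map (1 ∷_) (goodWords ℓ (2 + s)))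
                                          (length-goodWordsFrom ℓ 2 1 (suc s)))

-- The recurrences of #goodWords in terms of the closed form below, with f, g, h standing for factorials.
private
  ballot-step₀ : ∀ N₀ N₁ f g h ℓ → N₀ * (f * g) ≡ 2 * h → N₁ * (f * ((3 + ℓ) * g)) ≡ 3 * ((2 + ℓ + ℓ) * h) →
                 (N₁ + N₀) * ((1 + ℓ) * f * ((3 + ℓ) * g)) ≡ 2 * ((3 + ℓ + ℓ) * ((2 + ℓ + ℓ) * h))
  ballot-step₀ N₀ N₁ f g h ℓ e₀ e₁ = begin
    (N₁ + N₀) * ((1 + ℓ) * f * ((3 + ℓ) * g))
      ≡⟨ solve (N₀ ∷ N₁ ∷ f ∷ g ∷ ℓ ∷ []) ⟩
    (1 + ℓ) * (N₁ * (f * ((3 + ℓ) * g))) + (1 + ℓ) * (3 + ℓ) * (N₀ * (f * g))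
      ≡⟨ cong₂ (λ x y → (1 + ℓ) * x + (1 + ℓ) * (3 + ℓ) * y) e₁ e₀ ⟩
    (1 + ℓ) * (3 * ((2 + ℓ + ℓ) * h)) + (1 + ℓ) * (3 + ℓ) * (2 * h)
      ≡⟨ solve (h ∷ ℓ ∷ []) ⟩
    2 * ((3 + ℓ + ℓ) * ((2 + ℓ + ℓ) * h)) ∎
    where open ≡-Reasoning

  ballot-step : ∀ N₁ N₂ f g h s ℓ → N₁ * ((1 + ℓ) * f * g) ≡ (2 + s) * h →
                N₂ * (f * ((4 + (s + ℓ)) * g)) ≡ (4 + s) * h →
                (N₂ + N₁) * ((1 + ℓ) * f * ((4 + (s + ℓ)) * g)) ≡ (3 + s) * ((4 + (s + ℓ + ℓ)) * h)
  ballot-step N₁ N₂ f g h s ℓ e₁ e₂ = begin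
    (N₂ + N₁) * ((1 + ℓ) * f * ((4 + (s + ℓ)) * g))
      ≡⟨ solve (N₁ ∷ N₂ ∷ f ∷ g ∷ s ∷ ℓ ∷ []) ⟩
    (1 + ℓ) * (N₂ * (f * ((4 + (s + ℓ)) * g))) + (4 + (s + ℓ)) * (N₁ * ((1 + ℓ) * f * g))
      ≡⟨ cong₂ (λ x y → (1 + ℓ) * x + (4 + (s + ℓ)) * y) e₂ e₁ ⟩
    (1 + ℓ) * ((4 + s) * h) + (4 + (s + ℓ)) * ((2 + s) * h)
      ≡⟨ solve (h ∷ s ∷ ℓ ∷ []) ⟩
    (3 + s) * ((4 + (s + ℓ + ℓ)) * h) ∎
    where open ≡-Reasoning

-- The ballot numbers: #goodWords ℓ s = (s + 2) / (ℓ + s + 2) · C(2ℓ + s + 1, ℓ).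
#goodWords-closed-form : ∀ ℓ s → #goodWords ℓ s * (ℓ ! * (2 + s + ℓ) !) ≡ (2 + s) * (suc (s + ℓ + ℓ)) !
#goodWords-closed-form zero s rewrite +-identityʳ s | +-identityʳ s = identity s (suc s !)
  where
  identity : ∀ s x → 1 * (1 * ((2 + s) * x)) ≡ (2 + s) * x
  identity = solve-∀
#goodWords-closed-form (suc ℓ) zero = begin
  #goodWords (suc ℓ) 0 * (suc ℓ ! * (3 + ℓ) !)
    ≡⟨ cong (_* (suc ℓ ! * (3 + ℓ) !)) (#goodWords-suc-zero ℓ) ⟩
  (N₁ + N₀) * ((1 + ℓ) * ℓ ! * ((3 + ℓ) * (2 + ℓ) !))
    ≡⟨ ballot-step₀ N₀ N₁ (ℓ !) ((2 + ℓ) !) (suc (ℓ + ℓ) !) ℓ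
         (#goodWords-closed-form ℓ 0) (#goodWords-closed-form ℓ 1) ⟩
  2 * ((3 + ℓ + ℓ) * ((2 + ℓ + ℓ) * suc (ℓ + ℓ) !))
    ≡⟨ cong (λ n → 2 * suc n !) (+-suc (suc ℓ) ℓ) ⟨
  2 * suc (suc ℓ + suc ℓ) ! ∎
  where
  open ≡-Reasoning
  N₀ = #goodWords ℓ 0
  N₁ = #goodWords ℓ 1
#goodWords-closed-form (suc ℓ) (suc s) =
  step (#goodWords-closed-form (suc ℓ) s) (#goodWords-closed-form ℓ (2 + s))
  where
  u = s + ℓ
  H = (3 + (s + ℓ + ℓ)) !
  N₁ = #goodWords (suc ℓ) s
  N₂ = #goodWords ℓ (2 + s)
  e : s + suc ℓ + suc ℓ ≡ 2 + (s + ℓ + ℓ)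
  e = trans (cong (_+ suc ℓ) (+-suc s ℓ)) (cong suc (+-suc (s + ℓ) ℓ))
  step : N₁ * (suc ℓ ! * (2 + s + suc ℓ) !) ≡ (2 + s) * suc (s + suc ℓ + suc ℓ) ! →
         N₂ * (ℓ ! * (2 + (2 + s) + ℓ) !) ≡ (2 + (2 + s)) * suc (2 + s + ℓ + ℓ) ! →
         #goodWords (suc ℓ) (suc s) * (suc ℓ ! * (2 + suc s + suc ℓ) !) ≡ (2 + suc s) * suc (suc s + suc ℓ + suc ℓ) !
  step IH₁ IH₂ = begin
    #goodWords (suc ℓ) (suc s) * (suc ℓ ! * (2 + suc s + suc ℓ) !)
      ≡⟨ cong₂ (λ a b → a * (suc ℓ ! * b)) (#goodWords-suc-suc ℓ s) (cong (λ t → (3 + t) !) (+-suc s ℓ)) ⟩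
    (N₂ + N₁) * ((1 + ℓ) * ℓ ! * ((4 + u) * (3 + u) !))
      ≡⟨ ballot-step N₁ N₂ (ℓ !) ((3 + u) !) H s ℓ IH₁′ IH₂ ⟩
    (3 + s) * ((4 + (s + ℓ + ℓ)) * H)
      ≡⟨ cong (λ t → (3 + s) * suc t !) (cong suc e) ⟨
    (2 + suc s) * suc (suc s + suc ℓ + suc ℓ) ! ∎
    where
    open ≡-Reasoning
    IH₁′ : N₁ * ((1 + ℓ) * ℓ ! * (3 + u) !) ≡ (2 + s) * H
    IH₁′ = trans (cong (λ t → N₁ * (suc ℓ ! * (2 + t) !)) (sym (+-suc s ℓ)))
                 (trans IH₁ (cong (λ t → (2 + s) * suc t !) e))

#goodWords-ratio : ∀ ℓ → #goodWords (suc ℓ) 0 * (3 + ℓ) ≡ 2 * (3 + ℓ + ℓ) * #goodWords ℓ 0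
#goodWords-ratio ℓ = *-cancelʳ-≡ _ _ ((1 + ℓ) * (f * g)) {{m*n≢0 (1 + ℓ) (f * g) {{_}} {{ℓ !* (2 + ℓ) !≢0}}}} (begin
  N′ * (3 + ℓ) * ((1 + ℓ) * (f * g))         ≡⟨ e₁ N′ ℓ f g ⟩
  N′ * ((1 + ℓ) * f * ((3 + ℓ) * g))         ≡⟨ #goodWords-closed-form (suc ℓ) 0 ⟩
  2 * suc (suc ℓ + suc ℓ) !                  ≡⟨ cong (λ t → 2 * suc (suc t) !) (+-suc ℓ ℓ) ⟩
  2 * ((3 + ℓ + ℓ) * ((2 + ℓ + ℓ) * h))      ≡⟨ e₂ ℓ h ⟩
  2 * (3 + ℓ + ℓ) * (1 + ℓ) * (2 * h)        ≡⟨ cong (2 * (3 + ℓ + ℓ) * (1 + ℓ) *_) (#goodWords-closed-form ℓ 0) ⟨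
  2 * (3 + ℓ + ℓ) * (1 + ℓ) * (N * (f * g))  ≡⟨ e₃ ℓ N (f * g) ⟩
  2 * (3 + ℓ + ℓ) * N * ((1 + ℓ) * (f * g))  ∎)
  where
  open ≡-Reasoning
  N′ = #goodWords (suc ℓ) 0
  N = #goodWords ℓ 0
  f = ℓ !
  g = (2 + ℓ) !
  h = suc (ℓ + ℓ) !
  e₁ : ∀ N′ ℓ f g → N′ * (3 + ℓ) * ((1 + ℓ) * (f * g)) ≡ N′ * ((1 + ℓ) * f * ((3 + ℓ) * g))
  e₁ = solve-∀
  e₂ : ∀ ℓ h → 2 * ((3 + ℓ + ℓ) * ((2 + ℓ + ℓ) * h)) ≡ 2 * (3 + ℓ + ℓ) * (1 + ℓ) * (2 * h)
  e₂ = solve-∀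
  e₃ : ∀ ℓ N K → 2 * (3 + ℓ + ℓ) * (1 + ℓ) * (N * K) ≡ 2 * (3 + ℓ + ℓ) * N * ((1 + ℓ) * K)
  e₃ = solve-∀

#goodWords-lower-bound : ∀ ℓ → 2 * 4 ^ ℓ ≤ #goodWords ℓ 0 * ((1 + ℓ) * (2 + ℓ))
#goodWords-lower-bound zero    = s≤s (s≤s z≤n)
#goodWords-lower-bound (suc ℓ) = begin
  2 * (4 * 4 ^ ℓ)                       ≡⟨ e₁ (4 ^ ℓ) ⟩
  4 * (2 * 4 ^ ℓ)                       ≤⟨ *-monoʳ-≤ 4 (#goodWords-lower-bound ℓ) ⟩
  4 * (N * ((1 + ℓ) * (2 + ℓ)))         ≤⟨ ≤-by-offset (2 * (2 + ℓ) * N) (e₂ ℓ N) ⟩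
  (2 + ℓ) * (2 * (3 + ℓ + ℓ) * N)       ≡⟨ cong ((2 + ℓ) *_) (#goodWords-ratio ℓ) ⟨
  (2 + ℓ) * (N′ * (3 + ℓ))              ≡⟨ e₃ ℓ N′ ⟩
  N′ * ((2 + ℓ) * (3 + ℓ))              ∎
  where
  open ≤-Reasoning
  N = #goodWords ℓ 0
  N′ = #goodWords (suc ℓ) 0
  e₁ : ∀ x → 2 * (4 * x) ≡ 4 * (2 * x)
  e₁ = solve-∀
  e₂ : ∀ ℓ N → 4 * (N * ((1 + ℓ) * (2 + ℓ))) + 2 * (2 + ℓ) * N ≡ (2 + ℓ) * (2 * (3 + ℓ + ℓ) * N)
  e₂ = solve-∀
  e₃ : ∀ ℓ N′ → (2 + ℓ) * (N′ * (3 + ℓ)) ≡ N′ * ((2 + ℓ) * (3 + ℓ))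
  e₃ = solve-∀


-- The set S

cfValue-twos : ∀ i v → cfValue (replicate (suc i) 2 ++ v) ≡
  (pellB (1 + i) * cfDen v + pellB i * cfNum v , pellB (2 + i) * cfDen v + pellB (1 + i) * cfNum v)
cfValue-twos zero v = cong₂ _,_ (e₁ (cfDen v) (cfNum v)) (e₂ (cfDen v) (cfNum v))
  where
  e₁ : ∀ q p → q ≡ 1 * q + 0 * p
  e₁ = solve-∀
  e₂ : ∀ q p → 2 * q + p ≡ 2 * q + 1 * p
  e₂ = solve-∀
cfValue-twos (suc i) v = begin
  cfValue (2 ∷ X)                            ≡⟨ cong (λ c → proj₂ c , 2 * proj₂ c + proj₁ c) (cfValue-twos i v) ⟩
  (B₂ * q + B₁ * p , 2 * (B₂ * q + B₁ * p) + (B₁ * q + B₀ * p))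
    ≡⟨ cong (B₂ * q + B₁ * p ,_) (trans (e B₀ B₁ B₂ q p) (cong₂ (λ x y → x * q + y * p)
                                                             (sym (pellB-rec (1 + i))) (sym (pellB-rec i)))) ⟩
  (B₂ * q + B₁ * p , pellB (3 + i) * q + B₂ * p) ∎
  where
  open ≡-Reasoning
  X = replicate (suc i) 2 ++ v
  p = cfNum v
  q = cfDen v
  B₀ = pellB i
  B₁ = pellB (1 + i)
  B₂ = pellB (2 + i)
  e : ∀ B₀ B₁ B₂ q p → 2 * (B₂ * q + B₁ * p) + (B₁ * q + B₀ * p) ≡ (2 * B₂ + B₁) * q + (2 * B₁ + B₀) * p
  e = solve-∀

pad : ℕ → List ℕ → List ℕ
pad ℓ v = replicate (2 + ℓ) 2 ++ v

padDen : ℕ → List ℕ → ℕ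
padDen ℓ v = cfDen (pad ℓ v)

padDen≡ : ∀ ℓ v → padDen ℓ v ≡ pellB (3 + ℓ) * cfDen v + pellB (2 + ℓ) * cfNum v
padDen≡ ℓ v = cong proj₂ (cfValue-twos (suc ℓ) v)

goodWord-cfDen< : ∀ {ℓ v} → GoodWord ℓ 0 v → cfDen v < pellB (2 + ℓ)
goodWord-cfDen< {ℓ} {v} good =
  subst (λ n → cfDen v < pellB (2 + n)) length≡
        (cfDen<pellB positive (subst (λ n → sum v ≤ 2 * n) (sym length≡) (goodWord-sum good)))
  where open GoodWord good

-- padDen ℓ v = pellB (3 + ℓ) q + pellB (2 + ℓ) p with q < pellB (2 + ℓ) by cfDen<pellB: this is why v is
-- preceded by 2 + ℓ twos.
padDen-injective : ∀ {ℓ v v′} → GoodWord ℓ 0 v → GoodWord ℓ 0 v′ → padDen ℓ v ≡ padDen ℓ v′ → v ≡ v′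
padDen-injective {ℓ} {v} {v′} good good′ eq =
  cfValue-injective (GoodWord.positive good) (GoodWord.positive good′)
                    (trans (GoodWord.length≡ good) (sym (GoodWord.length≡ good′))) (cong₂ _,_ p≡p′ q≡q′)
  where
  B₃ = pellB (3 + ℓ)
  B₂ = pellB (2 + ℓ)
  eq′ : B₃ * cfDen v + B₂ * cfNum v ≡ B₃ * cfDen v′ + B₂ * cfNum v′
  eq′ = trans (sym (padDen≡ ℓ v)) (trans eq (padDen≡ ℓ v′))
  q≡q′ : cfDen v ≡ cfDen v′
  q≡q′ = coprime-combination-injective (pellB-coprime (2 + ℓ)) (goodWord-cfDen< good) (goodWord-cfDen< good′) eq′
  p≡p′ : cfNum v ≡ cfNum v′
  p≡p′ = *-cancelˡ-≡ (cfNum v) (cfNum v′) B₂ {{>-nonZero (≤-trans (s≤s z≤n) (n≤pellB (2 + ℓ)))}}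
           (+-cancelˡ-≡ (B₃ * cfDen v) _ _ (trans eq′ (cong (λ q → B₃ * q + B₂ * cfNum v′) (sym q≡q′))))

ℓ<padDen : ∀ {ℓ v} → GoodWord ℓ 0 v → ℓ < padDen ℓ v
ℓ<padDen {ℓ} {v} good = begin-strict
  ℓ                                      <⟨ m<n+m ℓ {2} (s≤s z≤n) ⟩
  2 + ℓ                                  ≤⟨ n≤1+n _ ⟩
  3 + ℓ                                  ≤⟨ n≤pellB (3 + ℓ) ⟩
  pellB (3 + ℓ)                          ≤⟨ m≤m*n (pellB (3 + ℓ)) (cfDen v) {{>-nonZero (cfDen-pos positive)}} ⟩
  pellB (3 + ℓ) * cfDen v                ≤⟨ m≤m+n _ _ ⟩
  pellB (3 + ℓ) * cfDen v + pellB (2 + ℓ) * cfNum v ≡⟨ padDen≡ ℓ v ⟨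
  padDen ℓ v                             ∎
  where
  open ≤-Reasoning
  open GoodWord good

threshold : ℕ → ℕ
threshold ℓ = pellA (5 + 2 * ℓ)

threshold-unbounded : ∀ k → k ≤ threshold k
threshold-unbounded k = ≤-trans (≤-trans (m≤n+m k (5 + k)) (≤-reflexive (e k)))
                                (≤-trans (n≤pellB (5 + 2 * k)) (pellB≤pellA (5 + 2 * k)))
  where
  e : ∀ k → 5 + k + k ≡ 5 + 2 * k
  e = solve-∀

padDen-bound : ∀ {ℓ v} → GoodWord ℓ 0 v → padDen ℓ v ≤ threshold ℓ
padDen-bound {ℓ} {v} good = begin
  padDen ℓ v                        ≡⟨ padDen≡ ℓ v ⟩
  B₃ * cfDen v + B₂ * cfNum v       ≤⟨ +-mono-≤ (*-monoʳ-≤ B₃ q≤B₂) (*-monoʳ-≤ B₂ (≤-trans (cfNum≤cfDen positive) q≤B₂)) ⟩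
  B₃ * B₂ + B₂ * B₂                 ≡⟨ *-distribʳ-+ B₂ B₃ B₂ ⟨
  (B₃ + B₂) * B₂                    ≡⟨ cong (_* B₂) (pellB-suc+pellB (2 + ℓ)) ⟩
  pellA (3 + ℓ) * B₂                ≤⟨ *-monoʳ-≤ (pellA (3 + ℓ)) (pellB≤pellA (2 + ℓ)) ⟩
  pellA (3 + ℓ) * pellA (2 + ℓ)     ≤⟨ pellA-*-≤ (3 + ℓ) (2 + ℓ) ⟩
  pellA (3 + ℓ + (2 + ℓ))           ≡⟨ cong pellA (e ℓ) ⟩
  pellA (5 + 2 * ℓ)                 ∎
  where
  open ≤-Reasoning
  open GoodWord good
  B₃ = pellB (3 + ℓ)
  B₂ = pellB (2 + ℓ)
  q≤B₂ : cfDen v ≤ B₂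
  q≤B₂ = <⇒≤ (goodWord-cfDen< good)
  e : ∀ ℓ → 3 + ℓ + (2 + ℓ) ≡ 5 + 2 * ℓ
  e = solve-∀

-- ℓ only needs to range below n because ℓ < padDen ℓ v.
S : Pred ℕ 0ℓ
S n = Any (λ ℓ → Any (λ v → padDen ℓ v ≡ n) (goodWords ℓ 0)) (upTo n)

S? : Decidable S
S? n = any? (λ ℓ → any? (λ v → padDen ℓ v ≟ n) (goodWords ℓ 0)) (upTo n)

S-elim : ∀ {n} → S n → ∃[ ℓ ] ∃[ v ] GoodWord ℓ 0 v × padDen ℓ v ≡ n
S-elim n∈S with ℓ , v∈ ← satisfied n∈S = ℓ , _ , All.lookupAny (goodWords-sound ℓ 0) v∈

S-positive : ∀ n → S n → 1 ≤ n
S-positive n n∈S with ℓ , v , good , refl ← S-elim n∈S = ≤-trans (s≤s z≤n) (ℓ<padDen good)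

padDen∈S : ∀ {ℓ v} → v ∈ goodWords ℓ 0 → S (padDen ℓ v)
padDen∈S {ℓ} v∈ = lose (∈-upTo⁺ (ℓ<padDen (All.lookup (goodWords-sound ℓ 0) v∈))) (lose v∈ refl)

#goodWords≤countUpTo : ∀ {ℓ N} → threshold ℓ ≤ N → #goodWords ℓ 0 ≤ countUpTo S? N
#goodWords≤countUpTo {ℓ} {N} bound≤N = injection-length-≤ (padDen ℓ) (goodWords-unique ℓ 0) injective ∈filter
  where
  good : ∀ {v} → v ∈ goodWords ℓ 0 → GoodWord ℓ 0 v
  good = All.lookup (goodWords-sound ℓ 0)
  injective : ∀ {v v′} → v ∈ goodWords ℓ 0 → v′ ∈ goodWords ℓ 0 → padDen ℓ v ≡ padDen ℓ v′ → v ≡ v′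
  injective v∈ v′∈ = padDen-injective (good v∈) (good v′∈)
  ∈filter : ∀ {v} → v ∈ goodWords ℓ 0 → padDen ℓ v ∈ filter S? (interval N)
  ∈filter v∈ = ∈-filter⁺ S? (∈-interval (≤-trans (s≤s z≤n) (ℓ<padDen (good v∈)))
                                         (≤-trans (padDen-bound (good v∈)) bound≤N))
                          (padDen∈S {ℓ} v∈)

HasBoundedCF : ℕ → Set
HasBoundedCF n = ∃[ k ] ∃[ as ]
  (1 ≤ k × k ≤ n × gcd k n ≡ 1 × All (1 ≤_) as × IsCFExpansion k n as × BoundedInAverageBy2 as)

padDen-hasBoundedCF : ∀ {ℓ v} → GoodWord ℓ 0 v → HasBoundedCF (padDen ℓ v)
padDen-hasBoundedCF {ℓ} {v} good =
  cfNum w , w , cfDen-pos positive′ , cfNum≤cfDen positive , coprime⇒gcd≡1 (cf-coprime w) , positive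
  , cf-isExpansion w , prefixBounded⇒boundedInAverageBy2 (prefixBounded-twos (2 + ℓ) (GoodWord.bounded good))
  where
  w = pad ℓ v
  positive′ : All (1 ≤_) (replicate (1 + ℓ) 2 ++ v)
  positive′ = ++⁺ (replicate⁺ (1 + ℓ) (s≤s z≤n)) (GoodWord.positive good)
  positive : All (1 ≤_) w
  positive = s≤s z≤n All.∷ positive′

S-hasBoundedCF : ∀ n → S n → HasBoundedCF n
S-hasBoundedCF n n∈S with ℓ , v , good , refl ← S-elim n∈S = padDen-hasBoundedCF good


-- Growth of S

-- With E = 2^r ∸ pellA p > √2 · pellB p, the functional a + b√2 ↦ x a + y b (y = 4 E pellB p) is scaled by at
-- most G / 2E = 2^r − 1 / 2E under multiplication by (1 + √2)^p; iterating bounds (1 + √2)^(m p).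
module Contraction (p r s : ℕ) (A<D : pellA p < 2 ^ r)
                   (E²≡ : suc (2 * (pellB p * pellB p)) + s ≡ (2 ^ r ∸ pellA p) * (2 ^ r ∸ pellA p)) where

  A = pellA p
  B = pellB p
  D = 2 ^ r
  E = D ∸ A
  x = 1 + 4 * (B * B) + 2 * s
  y = 4 * (E * B)
  G = 2 * E * A + x

  D≡A+E : D ≡ A + E
  D≡A+E = sym (m+[n∸m]≡n (<⇒≤ A<D))

  E≥1 : 1 ≤ E
  E≥1 = +-cancelˡ-≤ A 1 E (subst₂ _≤_ (+-comm 1 A) D≡A+E A<D)

  G+1≡2ED : suc G ≡ 2 * E * D
  G+1≡2ED = begin
    suc (2 * E * A + x)                        ≡⟨ e₁ E A B s ⟩
    2 * E * A + 2 * (suc (2 * (B * B)) + s)    ≡⟨ cong (λ t → 2 * E * A + 2 * t) E²≡ ⟩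
    2 * E * A + 2 * (E * E)                    ≡⟨ e₂ E A ⟩
    2 * E * (A + E)                            ≡⟨ cong (2 * E *_) D≡A+E ⟨
    2 * E * D                                  ∎
    where
    open ≡-Reasoning
    e₁ : ∀ E A B s → suc (2 * E * A + (1 + 4 * (B * B) + 2 * s)) ≡ 2 * E * A + 2 * (suc (2 * (B * B)) + s)
    e₁ = solve-∀
    e₂ : ∀ E A → 2 * E * A + 2 * (E * E) ≡ 2 * E * (A + E)
    e₂ = solve-∀

  2EyB≤x² : 2 * E * y * B ≤ x * x
  2EyB≤x² = begin
    2 * E * y * B                             ≡⟨ e₁ E B ⟩
    8 * (E * E) * (B * B)                     ≡⟨ cong (λ t → 8 * t * (B * B)) E²≡ ⟨
    8 * (suc (2 * (B * B)) + s) * (B * B)     ≤⟨ ≤-by-offset (1 + 4 * (s * s) + 4 * s + 8 * (B * B) * s) (e₂ B s) ⟩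
    x * x                                     ∎
    where
    open ≤-Reasoning
    e₁ : ∀ E B → 2 * E * (4 * (E * B)) * B ≡ 8 * (E * E) * (B * B)
    e₁ = solve-∀
    e₂ : ∀ B s → 8 * (suc (2 * (B * B)) + s) * (B * B) + (1 + 4 * (s * s) + 4 * s + 8 * (B * B) * s)
                 ≡ (1 + 4 * (B * B) + 2 * s) * (1 + 4 * (B * B) + 2 * s)
    e₂ = solve-∀

  W : ℕ → ℕ
  W m = x * pellA (m * p) + y * pellB (m * p)

  contraction : ∀ m → 2 * E * W (suc m) ≤ G * W m
  contraction m = +-cancelʳ-≤ (2 * E * y * B * a) (2 * E * W (suc m)) (G * W m) (begin
    2 * E * W (suc m) + 2 * E * y * B * a
      ≤⟨ +-monoʳ-≤ (2 * E * W (suc m)) (*-monoˡ-≤ a 2EyB≤x²) ⟩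
    2 * E * W (suc m) + x * x * a
      ≡⟨ cong₂ (λ a′ b′ → 2 * E * (x * a′ + y * b′) + x * x * a) (pellA-+ p (m * p)) (pellB-+ p (m * p)) ⟩
    2 * E * (x * (A * a + 2 * (B * b)) + y * (A * b + B * a)) + x * x * a
      ≡⟨ e E A B x a b ⟨
    G * W m + 2 * E * y * B * a ∎)
    where
    open ≤-Reasoning
    a = pellA (m * p)
    b = pellB (m * p)
    e : ∀ E A B x a b → (2 * E * A + x) * (x * a + 4 * (E * B) * b) + 2 * E * (4 * (E * B)) * B * a
                       ≡ 2 * E * (x * (A * a + 2 * (B * b)) + 4 * (E * B) * (A * b + B * a)) + x * x * a
    e = solve-∀

  iterate : ∀ m → (2 * E) ^ m * W m ≤ G ^ m * x
  iterate zero    = ≤-reflexive (e x y)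
    where
    e : ∀ x y → 1 * (x * 1 + y * 0) ≡ 1 * x
    e = solve-∀
  iterate (suc m) = begin
    2 * E * (2 * E) ^ m * W (suc m)     ≡⟨ e₁ (2 * E) ((2 * E) ^ m) (W (suc m)) ⟩
    (2 * E) ^ m * (2 * E * W (suc m))   ≤⟨ *-monoʳ-≤ ((2 * E) ^ m) (contraction m) ⟩
    (2 * E) ^ m * (G * W m)             ≡⟨ e₂ ((2 * E) ^ m) G (W m) ⟩
    G * ((2 * E) ^ m * W m)             ≤⟨ *-monoʳ-≤ G (iterate m) ⟩
    G * (G ^ m * x)                     ≡⟨ *-assoc G (G ^ m) x ⟨
    G * G ^ m * x                       ∎
    where
    open ≤-Reasoning
    e₁ : ∀ c d w → c * d * w ≡ d * (c * w)
    e₁ = solve-∀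
    e₂ : ∀ c g w → c * (g * w) ≡ g * (c * w)
    e₂ = solve-∀

  pellA-bound : ∀ m → (2 * E) ^ m * pellA (m * p) ≤ x * G ^ m
  pellA-bound m = begin
    (2 * E) ^ m * pellA (m * p)   ≤⟨ *-monoʳ-≤ ((2 * E) ^ m) (≤-trans (m≤n*m _ x) (m≤m+n _ _)) ⟩
    (2 * E) ^ m * W m             ≤⟨ iterate m ⟩
    G ^ m * x                     ≡⟨ *-comm (G ^ m) x ⟩
    x * G ^ m                     ∎
    where open ≤-Reasoning

pellA-geometric : ∀ p r → PowLt p r →
  ∃[ F ] ∃[ G ] ∃[ c ] (1 ≤ F × suc G ≡ F * 2 ^ r × ∀ m → F ^ m * pellA (m * p) ≤ c * G ^ m)
pellA-geometric p r (A<D , 2B²<E²) with s , E²≡ ← m≤n⇒∃[o]m+o≡n 2B²<E² =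
  2 * E , G , x , *-mono-≤ (s≤s (z≤n {1})) E≥1 , G+1≡2ED , pellA-bound
  where open Contraction p r s A<D E²≡

threshold^p-bound : ∀ {p F G c} → (∀ m → F ^ m * pellA (m * p) ≤ c * G ^ m) →
                    ∀ ℓ → F ^ (7 + 2 * ℓ) * threshold (suc ℓ) ^ p ≤ c * G ^ 7 * (G ^ 2) ^ ℓ
threshold^p-bound {p} {F} {G} {c} geometric ℓ = begin
  F ^ m * pellA (5 + 2 * suc ℓ) ^ p   ≡⟨ cong (λ n → F ^ m * pellA n ^ p) (e ℓ) ⟩
  F ^ m * pellA m ^ p                 ≤⟨ *-monoʳ-≤ (F ^ m) (subst (pellA m ^ p ≤_) (cong pellA (*-comm p m)) (pellA-^-≤ m p)) ⟩
  F ^ m * pellA (m * p)               ≤⟨ geometric m ⟩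
  c * G ^ m                           ≡⟨ cong (c *_) (^-distribˡ-+-* G 7 (2 * ℓ)) ⟩
  c * (G ^ 7 * G ^ (2 * ℓ))           ≡⟨ cong (λ x → c * (G ^ 7 * x)) (^-*-assoc G 2 ℓ) ⟨
  c * (G ^ 7 * (G ^ 2) ^ ℓ)           ≡⟨ *-assoc c (G ^ 7) ((G ^ 2) ^ ℓ) ⟨
  c * G ^ 7 * (G ^ 2) ^ ℓ             ∎
  where
  open ≤-Reasoning
  m = 7 + 2 * ℓ
  e : ∀ ℓ → 5 + 2 * suc ℓ ≡ 7 + 2 * ℓ
  e = solve-∀

1+G²^ℓ-bound : ∀ {r F G} → 1 ≤ F → suc G ≡ F * 2 ^ r → ∀ ℓ → (1 + G ^ 2) ^ ℓ ≤ F ^ (7 + 2 * ℓ) * (4 ^ ℓ) ^ r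
1+G²^ℓ-bound {r} {F} {G} F≥1 G+1≡FD ℓ = begin
  (1 + G ^ 2) ^ ℓ                ≤⟨ ^-monoˡ-≤ ℓ (≤-by-offset (2 * G) (e₁ G)) ⟩
  (suc G ^ 2) ^ ℓ                ≡⟨ cong (λ x → (x ^ 2) ^ ℓ) G+1≡FD ⟩
  ((F * D) ^ 2) ^ ℓ              ≡⟨ ^-*-assoc (F * D) 2 ℓ ⟩
  (F * D) ^ (2 * ℓ)              ≡⟨ ^-distribʳ-* F D (2 * ℓ) ⟩
  F ^ (2 * ℓ) * D ^ (2 * ℓ)      ≤⟨ *-monoˡ-≤ (D ^ (2 * ℓ)) (^-monoʳ-≤ F {{>-nonZero F≥1}} (m≤n+m (2 * ℓ) 7)) ⟩
  F ^ (7 + 2 * ℓ) * D ^ (2 * ℓ)  ≡⟨ cong (F ^ (7 + 2 * ℓ) *_) D^2ℓ≡ ⟩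
  F ^ (7 + 2 * ℓ) * (4 ^ ℓ) ^ r  ∎
  where
  open ≤-Reasoning
  D = 2 ^ r
  e₁ : ∀ G → 1 + G * (G * 1) + 2 * G ≡ suc G * (suc G * 1)
  e₁ = solve-∀
  e₂ : ∀ r ℓ → r * (2 * ℓ) ≡ 2 * (ℓ * r)
  e₂ = solve-∀
  D^2ℓ≡ : D ^ (2 * ℓ) ≡ (4 ^ ℓ) ^ r
  D^2ℓ≡ = begin-equality
    (2 ^ r) ^ (2 * ℓ)    ≡⟨ ^-*-assoc 2 r (2 * ℓ) ⟩
    2 ^ (r * (2 * ℓ))    ≡⟨ cong (2 ^_) (e₂ r ℓ) ⟩
    2 ^ (2 * (ℓ * r))    ≡⟨ ^-*-assoc 2 2 (ℓ * r) ⟨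
    4 ^ (ℓ * r)          ≡⟨ ^-*-assoc 4 ℓ r ⟨
    (4 ^ ℓ) ^ r          ∎

-- Since G < F · 2^r, a polynomial times (G²)^ℓ stays below (F · 2^r)^(2ℓ) = F^(2ℓ) (4^ℓ)^r, and 4^ℓ is
-- below #goodWords ℓ 0 up to the polynomial factor P ℓ.
threshold^p≤#goodWords^r : ∀ p r → PowLt p r →
                           ∃[ L ] ∀ ℓ → L ≤ ℓ → threshold (suc ℓ) ^ p ≤ #goodWords ℓ 0 ^ r
threshold^p≤#goodWords^r p r powLt with pellA-geometric p r powLt
... | F , G , c , F≥1 , G+1≡FD , geometric with L , poly≤exp ← poly*exp≤exp (c * G ^ 7) (2 * r) (G ^ 2) =
  L , λ ℓ L≤ℓ → *-cancelʳ-≤ (threshold (suc ℓ) ^ p) (#goodWords ℓ 0 ^ r) (P ℓ ^ r) {{m^n≢0 (P ℓ) r}} (begin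
    threshold (suc ℓ) ^ p * P ℓ ^ r  ≤⟨ *-cancelˡ-≤ (F ^ (7 + 2 * ℓ)) {{m^n≢0 F (7 + 2 * ℓ) {{>-nonZero F≥1}}}}
                                         (analytic ℓ L≤ℓ) ⟩
    (4 ^ ℓ) ^ r                      ≤⟨ ^-monoˡ-≤ r (≤-trans (m≤m+n (4 ^ ℓ) _) (#goodWords-lower-bound ℓ)) ⟩
    (#goodWords ℓ 0 * P ℓ) ^ r       ≡⟨ ^-distribʳ-* (#goodWords ℓ 0) (P ℓ) r ⟩
    #goodWords ℓ 0 ^ r * P ℓ ^ r     ∎)
  where
  open ≤-Reasoning
  P : ℕ → ℕ
  P ℓ = (1 + ℓ) * (2 + ℓ)
  P^r≤ : ∀ ℓ → P ℓ ^ r ≤ (2 + ℓ) ^ (2 * r)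
  P^r≤ ℓ = begin
    P ℓ ^ r                  ≤⟨ ^-monoˡ-≤ r (*-monoˡ-≤ (2 + ℓ) (n≤1+n (1 + ℓ))) ⟩
    ((2 + ℓ) * (2 + ℓ)) ^ r  ≡⟨ cong (λ x → ((2 + ℓ) * x) ^ r) (*-identityʳ (2 + ℓ)) ⟨
    ((2 + ℓ) ^ 2) ^ r        ≡⟨ ^-*-assoc (2 + ℓ) 2 r ⟩
    (2 + ℓ) ^ (2 * r)        ∎
  e : ∀ a b c → a * b * c ≡ a * c * b
  e = solve-∀
  analytic : ∀ ℓ → L ≤ ℓ → F ^ (7 + 2 * ℓ) * (threshold (suc ℓ) ^ p * P ℓ ^ r) ≤ F ^ (7 + 2 * ℓ) * (4 ^ ℓ) ^ r
  analytic ℓ L≤ℓ = begin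
    F ^ m * (threshold (suc ℓ) ^ p * P ℓ ^ r)    ≡⟨ *-assoc (F ^ m) (threshold (suc ℓ) ^ p) (P ℓ ^ r) ⟨
    F ^ m * threshold (suc ℓ) ^ p * P ℓ ^ r      ≤⟨ *-monoˡ-≤ (P ℓ ^ r) (threshold^p-bound {p} {F} {G} {c} geometric ℓ) ⟩
    c * G ^ 7 * (G ^ 2) ^ ℓ * P ℓ ^ r             ≤⟨ *-monoʳ-≤ (c * G ^ 7 * (G ^ 2) ^ ℓ) (P^r≤ ℓ) ⟩
    c * G ^ 7 * (G ^ 2) ^ ℓ * (2 + ℓ) ^ (2 * r)   ≡⟨ e (c * G ^ 7) ((G ^ 2) ^ ℓ) ((2 + ℓ) ^ (2 * r)) ⟩
    c * G ^ 7 * (2 + ℓ) ^ (2 * r) * (G ^ 2) ^ ℓ   ≤⟨ poly≤exp ℓ L≤ℓ ⟩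
    (1 + G ^ 2) ^ ℓ                              ≤⟨ 1+G²^ℓ-bound {r} {F} F≥1 G+1≡FD ℓ ⟩
    F ^ m * (4 ^ ℓ) ^ r                          ∎
    where m = 7 + 2 * ℓ

S-growth : ∀ p r → PowLt p r → ∃[ N ] ∀ n → N ≤ n → n ^ p ≤ countUpTo S? n ^ r
S-growth p r powLt = threshold L , growth
  where
  L = proj₁ (threshold^p≤#goodWords^r p r powLt)
  step = proj₂ (threshold^p≤#goodWords^r p r powLt)
  growth : ∀ n → threshold L ≤ n → n ^ p ≤ countUpTo S? n ^ r
  growth n TL≤n with ℓ , L≤ℓ , Tℓ≤n , n<Tℓ′ ← bracket threshold threshold-unbounded TL≤n = begin
    n ^ p                       ≤⟨ ^-monoˡ-≤ p (<⇒≤ n<Tℓ′) ⟩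
    threshold (suc ℓ) ^ p       ≤⟨ step ℓ L≤ℓ ⟩
    #goodWords ℓ 0 ^ r          ≤⟨ ^-monoˡ-≤ r (#goodWords≤countUpTo {ℓ} Tℓ≤n) ⟩
    countUpTo S? n ^ r          ∎
    where open ≤-Reasoning

corollary1 : Σ (Pred ℕ 0ℓ) λ S → Σ (Decidable S) λ S? →
    (∀ n → S n → 1 ≤ n)
    × (∀ p r → 1 ≤ r → PowLt p r →
         ∃[ N ] ∀ n → N ≤ n → n ^ p ≤ countUpTo S? n ^ r)
    × (∀ n → S n → ∃[ k ] ∃[ as ]
         (1 ≤ k × k ≤ n × gcd k n ≡ 1 × All (1 ≤_) as
          × IsCFExpansion k n as × BoundedInAverageBy2 as))
corollary1 = S , S? , S-positive , (λ p r _ → S-growth p r) , S-hasBoundedCF
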